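{- After the decomposition algorithm has processed all $m$ columns of $\mathrm{PA}$, for each $1\le c\le h$ the refined segments in $\mathrm{RS}[c]$ partition the interval $[1,m]$.
   Context: Setting: haplotypes $S_1,\dots,S_h$ of length $m$; prefix array $\mathrm{PA}$ ($h\times m$, column $1$ is $1,\dots,h$, column $j>1$ sorts indices by co-lexicographic order of $S_i[1..j-1]$, ties broken stably); PBWT with $\mathrm{col}_j(\mathrm{PBWT})[x]=S_{\mathrm{col}_j(\mathrm{PA})[x]}[j]$; $(x,j)$ is a run-top if $x=1$ or $\mathrm{col}_j(\mathrm{PBWT})[x]\ne\mathrm{col}_j(\mathrm{PBWT})[x-1]$. Haplotype intervals of $S_i$: with $b_1<\dots<b_k=m$ the set of $m$ and all columns $j$ such that some run-top $(x,j)$ has $\mathrm{col}_j(\mathrm{PA})[x]=i$, they are $[1,b_1],[b_1+1,b_2],\dots,[b_{k-1}+1,b_k]$. Two intervals overlap if they share an integer. Decomposition algorithm with integer parameter $d>1$: initially, for each $c$, $L_c$ is the linked list of haplotype intervals of $S_c$ in increasing order and $\mathrm{RS}[c]$ is empty. For $j=1,\dots,m$ and, within each $j$, for $i=1,\dots,h$: let $c=\mathrm{col}_j(\mathrm{PA})[i]$ and let $[b_c,e_c]$ be the first interval of $L_c$. If $j=e_c$, remove $[b_c,e_c]$ from $L_c$ and append it to the tail of $\mathrm{RS}[c]$ (Passive Split). Otherwise, if $i>1$ and $[b_c,j]$ overlaps exactly $d$ refined segments currently in $\mathrm{RS}[c']$, where $c'=\mathrm{col}_j(\mathrm{PA})[i-1]$,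 append $[b_c,j]$ to $\mathrm{RS}[c]$ and replace the head $[b_c,e_c]$ of $L_c$ by $[j+1,e_c]$ (Active Split). Intervals in the lists $\mathrm{RS}[\cdot]$ are called refined segments. -}

module Defs where

open import Data.Nat using (ℕ; zero; suc; _∸_; _≤_; _<_; _≤ᵇ_; _<ᵇ_; _≡ᵇ_; _<?_)
open import Data.Fin using (Fin; toℕ; fromℕ<)
open import Data.Bool using (Bool; true; false; if_then_else_; _∧_; _∨_)
open import Data.List using (List; []; _∷_; [_]; map; length; reverse; _++_; upTo; allFin; foldl; foldr; filterᵇ)
open import Data.Bool.ListAction using (any)
open import Data.List.Relation.Unary.All using (All)
open import Data.Maybe using (Maybe; just; nothing)
open import Data.Product using (_×_; _,_; proj₁; proj₂)
open import Relation.Binary.PropositionalEquality using (_≡_)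
open import Relation.Nullary using (yes; no)

-- h haplotypes of length m over the alphabet ℕ (0-based Fin indices internally;
-- all positions/columns below are 1-based naturals as in the paper).
Haplotypes : ℕ → ℕ → Set
Haplotypes h m = Fin h → Fin m → ℕ

-- 1-based access S_i[j]; value 0 outside 1..m (never used by the algorithm)
at : ∀ {m} → (Fin m → ℕ) → ℕ → ℕ
at s zero = 0
at {m} s (suc j) with j <? m
... | yes p = s (fromℕ< p)
... | no _  = 0

Interval : Set
Interval = ℕ × ℕ            -- (b , e) denotes [b , e]

lexLess : List ℕ → List ℕ → Bool
lexLess [] [] = false
lexLess [] (_ ∷ _) = true
lexLess (_ ∷ _) [] = false
lexLess (x ∷ xs) (y ∷ ys) = (x <ᵇ y) ∨ ((x ≡ᵇ y) ∧ lexLess xs ys)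

lexEq : List ℕ → List ℕ → Bool
lexEq [] [] = true
lexEq (x ∷ xs) (y ∷ ys) = (x ≡ᵇ y) ∧ lexEq xs ys
lexEq _ _ = false

insertBy : ∀ {A : Set} → (A → A → Bool) → A → List A → List A
insertBy lt x [] = x ∷ []
insertBy lt x (y ∷ ys) = if lt x y then x ∷ y ∷ ys else y ∷ insertBy lt x ys

sortBy : ∀ {A : Set} → (A → A → Bool) → List A → List A
sortBy lt = foldr (insertBy lt) []

finEq : ∀ {h} → Fin h → Fin h → Bool
finEq a b = toℕ a ≡ᵇ toℕ b

overlaps : Interval → Interval → Bool
overlaps (a , b) (x , y) = (a ≤ᵇ b) ∧ (x ≤ᵇ y) ∧ (a ≤ᵇ y) ∧ (x ≤ᵇ b)

contains : Interval → ℕ → Bool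
contains (a , b) k = (a ≤ᵇ k) ∧ (k ≤ᵇ b)

set : ∀ {h} {A : Set} → (Fin h → A) → Fin h → A → (Fin h → A)
set f c v c' = if finEq c' c then v else f c'

module Algo (h m d : ℕ) (S : Haplotypes h m) where

  sym : Fin h → ℕ → ℕ
  sym i j = at (S i) j

  -- co-lexicographic key of S_i[1..j-1]: the reversed prefix
  key : ℕ → Fin h → List ℕ
  key j i = reverse (map (λ k → sym i (suc k)) (upTo (j ∸ 1)))

  before : ℕ → Fin h → Fin h → Bool
  before j a b = lexLess (key j a) (key j b)
               ∨ (lexEq (key j a) (key j b) ∧ (toℕ a <ᵇ toℕ b))

  PAcol : ℕ → List (Fin h)
  PAcol j = sortBy (before j) (allFin h)

  PBWTcol : ℕ → List ℕ
  PBWTcol j = map (λ i → sym i j) (PAcol j)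

  -- haplotype indices col_j(PA)[x] over all run-tops (x , j)
  runTopOwnersAux : ℕ → ℕ → List (Fin h) → List (Fin h)
  runTopOwnersAux j p [] = []
  runTopOwnersAux j p (c ∷ cs) =
    if sym c j ≡ᵇ p then runTopOwnersAux j p cs
    else c ∷ runTopOwnersAux j (sym c j) cs

  runTopOwners : ℕ → List (Fin h)
  runTopOwners j with PAcol j
  ... | [] = []
  ... | c ∷ cs = c ∷ runTopOwnersAux j (sym c j) cs

  columns : List ℕ
  columns = map suc (upTo m)

  boundaries : Fin h → List ℕ
  boundaries c = filterᵇ (λ j → (j ≡ᵇ m) ∨ any (finEq c) (runTopOwners j)) columns

  intervalsFrom : ℕ → List ℕ → List Interval
  intervalsFrom s [] = []
  intervalsFrom s (b ∷ bs) = (s , b) ∷ intervalsFrom (suc b) bs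

  hapIntervals : Fin h → List Interval
  hapIntervals c = intervalsFrom 1 (boundaries c)

  State : Set
  State = (Fin h → List Interval) × (Fin h → List Interval)   -- (L , RS)

  initial : State
  initial = hapIntervals , (λ _ → [])

  numOverlap : Interval → List Interval → ℕ
  numOverlap I segs = length (filterᵇ (overlaps I) segs)

  -- processing of entry c = col_j(PA)[i]; prev = col_j(PA)[i-1] (nothing if i = 1)
  activeStep : ℕ → Maybe (Fin h) → Fin h → ℕ → ℕ → List Interval → State → State
  activeStep j nothing c b e rest st = st
  activeStep j (just c') c b e rest (L , RS) =
    if numOverlap (b , j) (RS c') ≡ᵇ d
    then (set L c ((suc j , e) ∷ rest) , set RS c (RS c ++ [ (b , j) ]))
    else (L , RS)

  stepCell : ℕ → Maybe (Fin h) → Fin h → State → State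
  stepCell j prev c (L , RS) with L c
  ... | [] = (L , RS)
  ... | (b , e) ∷ rest =
    if j ≡ᵇ e
    then (set L c rest , set RS c (RS c ++ [ (b , e) ]))
    else activeStep j prev c b e rest (L , RS)

  processCol : ℕ → Maybe (Fin h) → List (Fin h) → State → State
  processCol j prev [] st = st
  processCol j prev (c ∷ cs) st = processCol j (just c) cs (stepCell j prev c st)

  final : State
  final = foldl (λ st j → processCol j nothing (PAcol j) st) initial columns

  finalRS : Fin h → List Interval
  finalRS = proj₂ final

refinedSegments : (h m d : ℕ) → Haplotypes h m → Fin h → List Interval
refinedSegments h m d S = Algo.finalRS h m d S

countContaining : ℕ → List Interval → ℕ
countContaining k segs = length (filterᵇ (λ I → contains I k) segs)

PartitionsInterval : ℕ → List Interval → Set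
PartitionsInterval m segs =
  All (λ I → (1 ≤ proj₁ I) × (proj₁ I ≤ proj₂ I) × (proj₂ I ≤ m)) segs
  × (∀ k → 1 ≤ k → k ≤ m → countContaining k segs ≡ 1)

{-# OPTIONS --safe #-}
-- For a fixed haplotype c, the list RS[c] ++ L[c] always tiles [1, m] by consecutive nonempty
-- intervals, and when column j is processed the current column lies in the head of L[c].  Each
-- column of PA is a permutation of the haplotypes, so c is visited exactly once per column; that
-- visit either leaves both lists alone or moves an initial piece of the head interval of L[c] to
-- the end of RS[c], which preserves the tiling.  After column m the head of L[c] would have to
-- contain m + 1, so L[c] is empty and RS[c] alone tiles [1, m].
module Submission where

open import Defs
open import Data.Nat using (ℕ; zero; suc; _≤_; _<_; z≤n; s≤s; _≤ᵇ_; _≡ᵇ_)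
open import Data.Fin using (Fin; toℕ)

open import Data.Bool using (Bool; true; false; _∨_)
open import Data.Bool.ListAction using (any)
open import Data.Bool.Properties using (T-≡)
open import Data.Fin.Properties using (toℕ-injective)
open import Data.List using (List; []; _∷_; [_]; _++_; applyUpTo; allFin; foldl; filterᵇ)
open import Data.List.Properties using (map-applyUpTo)
open import Data.List.Membership.Propositional using (_∈_)
open import Data.List.Membership.Propositional.Properties using (∈-allFin)
open import Data.List.Relation.Binary.Permutation.Propositional using (_↭_; refl; prep; swap; trans; ↭-sym; ↭⇒↭ₛ)
open import Data.List.Relation.Binary.Permutation.Propositional.Properties using (∈-resp-↭)
import Data.List.Relation.Binary.Permutation.Setoid.Properties as SetoidPermutation
open import Data.List.Relation.Unary.All as All using (All; []; _∷_)
open import Data.List.Relation.Unary.AllPairs using (_∷_)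
open import Data.List.Relation.Unary.Any using (here; there)
open import Data.List.Relation.Unary.Unique.Propositional using (Unique)
open import Data.List.Relation.Unary.Unique.Propositional.Properties using (allFin⁺)
open import Data.Maybe using (just; nothing)
open import Data.Nat.Properties
open import Data.Product using (∃-syntax; _×_; _,_; proj₁; proj₂)
open import Data.Unit using (⊤; tt)
open import Function using (Equivalence; _∘_; id)
open import Relation.Nullary using (contradiction)
open import Relation.Nullary.Reflects using (Reflects; ofʸ; ofⁿ; fromEquivalence)
open import Relation.Binary.PropositionalEquality
  using (_≡_; _≢_; refl; sym; cong; cong₂; subst; ≢-sym; setoid)
  renaming (trans to ≡-trans)

≡ᵇ-reflects-≡ : ∀ m n → Reflects (m ≡ n) (m ≡ᵇ n)
≡ᵇ-reflects-≡ m n = fromEquivalence (≡ᵇ⇒≡ m n) (≡⇒≡ᵇ m n)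

≤ᵇ-true : ∀ {m n} → m ≤ n → (m ≤ᵇ n) ≡ true
≤ᵇ-true m≤n = Equivalence.to T-≡ (≤⇒≤ᵇ m≤n)

≤ᵇ-false : ∀ {m n} → n < m → (m ≤ᵇ n) ≡ false
≤ᵇ-false {m} {n} n<m with m ≤ᵇ n | ≤ᵇ-reflects-≤ m n
... | false | _       = refl
... | true  | ofʸ m≤n = contradiction m≤n (<⇒≱ n<m)

≡ᵇ-refl : ∀ n → (n ≡ᵇ n) ≡ true
≡ᵇ-refl n = Equivalence.to T-≡ (≡⇒≡ᵇ n n refl)

finEq-refl : ∀ {h} (c : Fin h) → finEq c c ≡ true
finEq-refl c = ≡ᵇ-refl (toℕ c)

finEq-≢ : ∀ {h} {c x : Fin h} → c ≢ x → finEq c x ≡ false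
finEq-≢ {c = c} {x} c≢x with finEq c x | ≡ᵇ-reflects-≡ (toℕ c) (toℕ x)
... | false | _     = refl
... | true  | ofʸ p = contradiction (toℕ-injective p) c≢x

set-same : ∀ {h} {A : Set} (f : Fin h → A) c v → set f c v c ≡ v
set-same f c v rewrite finEq-refl c = refl

set-other : ∀ {h} {A : Set} (f : Fin h → A) {x} v {c} → c ≢ x → set f x v c ≡ f c
set-other f v c≢x rewrite finEq-≢ c≢x = refl

data Tiles : ℕ → List Interval → ℕ → Set where
  done : ∀ {s} → Tiles s [] s
  tile : ∀ {b e xs t} → b ≤ e → Tiles (suc e) xs t → Tiles b ((b , e) ∷ xs) t

tiles-≤ : ∀ {s xs t} → Tiles s xs t → s ≤ t
tiles-≤ done                = ≤-refl
tiles-≤ (tile b≤e xs-tiles) = ≤-trans (m≤n⇒m≤1+n b≤e) (tiles-≤ xs-tiles)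

tiles-++ : ∀ {r xs s ys t} → Tiles r xs s → Tiles s ys t → Tiles r (xs ++ ys) t
tiles-++ done                ys-tiles = ys-tiles
tiles-++ (tile b≤e xs-tiles) ys-tiles = tile b≤e (tiles-++ xs-tiles ys-tiles)

tiles-bounds : ∀ {s xs t} → Tiles s xs t →
  All (λ I → s ≤ proj₁ I × proj₁ I ≤ proj₂ I × proj₂ I < t) xs
tiles-bounds done                = []
tiles-bounds (tile b≤e xs-tiles) =
  (≤-refl , b≤e , tiles-≤ xs-tiles)
  ∷ All.map (λ (s≤b , b≤e′ , e′<t) → ≤-trans (m≤n⇒m≤1+n b≤e) s≤b , b≤e′ , e′<t)
            (tiles-bounds xs-tiles)

countContaining-below : ∀ {s xs t k} → Tiles s xs t → k < s → countContaining k xs ≡ 0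
countContaining-below done                k<s = refl
countContaining-below (tile b≤e xs-tiles) k<b rewrite ≤ᵇ-false k<b =
  countContaining-below xs-tiles (≤-trans k<b (m≤n⇒m≤1+n b≤e))

countContaining-tiles : ∀ {s xs t k} → Tiles s xs t → s ≤ k → k < t → countContaining k xs ≡ 1
countContaining-tiles done s≤k k<s = contradiction s≤k (<⇒≱ k<s)
countContaining-tiles {k = k} (tile {e = e} b≤e xs-tiles) b≤k k<t
  rewrite ≤ᵇ-true b≤k with k ≤ᵇ e | ≤ᵇ-reflects-≤ k e
... | true  | ofʸ k≤e = cong suc (countContaining-below xs-tiles (s≤s k≤e))
... | false | ofⁿ k≰e = countContaining-tiles xs-tiles (≰⇒> k≰e) k<t

tiles⇒partitions : ∀ {m xs} → Tiles 1 xs (suc m) → PartitionsInterval m xs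
tiles⇒partitions xs-tiles =
  All.map (λ (1≤b , b≤e , e<1+m) → 1≤b , b≤e , ≤-pred e<1+m) (tiles-bounds xs-tiles)
  , λ k 1≤k k≤m → countContaining-tiles xs-tiles 1≤k (s≤s k≤m)

Consecutive : (ℕ → ℕ) → Set
Consecutive f = ∀ i → f (suc i) ≡ suc (f i)

foldl-applyUpTo-preserves : ∀ {A : Set} (P : ℕ → A → Set) (g : A → ℕ → A) →
  (∀ {j a} → P j a → P (suc j) (g a j)) →
  ∀ {f} → Consecutive f → ∀ n {a} → P (f 0) a → P (f n) (foldl g a (applyUpTo f n))
foldl-applyUpTo-preserves P g step f-cons zero    pa = pa
foldl-applyUpTo-preserves P g step {f} f-cons (suc n) {a} pa =
  foldl-applyUpTo-preserves P g step (f-cons ∘ suc) n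
    (subst (λ j → P j (g a (f 0))) (sym (f-cons 0)) (step pa))

insertBy-↭ : ∀ {A : Set} lt (x : A) ys → insertBy lt x ys ↭ x ∷ ys
insertBy-↭ lt x []       = refl
insertBy-↭ lt x (y ∷ ys) with lt x y
... | true  = refl
... | false = trans (prep y (insertBy-↭ lt x ys)) (swap y x refl)

sortBy-↭ : ∀ {A : Set} lt (xs : List A) → sortBy lt xs ↭ xs
sortBy-↭ lt []       = refl
sortBy-↭ lt (x ∷ xs) = trans (insertBy-↭ lt x (sortBy lt xs)) (prep x (sortBy-↭ lt xs))

data Step (j : ℕ) : List Interval × List Interval → List Interval × List Interval → Set where
  idle    : ∀ {RS} → Step j ([] , RS) ([] , RS)
  passive : ∀ {b e rest RS} → j ≡ e →
            Step j ((b , e) ∷ rest , RS) (rest , RS ++ [ (b , e) ])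
  active  : ∀ {b e rest RS} → j ≢ e →
            Step j ((b , e) ∷ rest , RS) ((suc j , e) ∷ rest , RS ++ [ (b , j) ])
  skip    : ∀ {b e rest RS} → j ≢ e →
            Step j ((b , e) ∷ rest , RS) ((b , e) ∷ rest , RS)

HeadContains : ℕ → List Interval → Set
HeadContains j []            = ⊤
HeadContains j ((b , e) ∷ _) = b ≤ j × j ≤ e

Progress : ℕ → ℕ → List Interval × List Interval → Set
Progress t j (L , RS) = ∃[ s ] Tiles 1 RS s × Tiles s L t × HeadContains j L

tiles-headContains : ∀ {s xs t} → Tiles s xs t → HeadContains s xs
tiles-headContains done         = tt
tiles-headContains (tile b≤e _) = ≤-refl , b≤e

step-progress : ∀ {t j x y} → Step j x y → Progress t j x → Progress t (suc j) y
step-progress idle (s , RS-tiles , L-tiles , _) = s , RS-tiles , L-tiles , tt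
step-progress (passive refl) (b , RS-tiles , tile b≤e rest-tiles , _) =
  suc _ , tiles-++ RS-tiles (tile b≤e done) , rest-tiles , tiles-headContains rest-tiles
step-progress (active j≢e) (b , RS-tiles , tile _ rest-tiles , b≤j , j≤e) =
  suc _ , tiles-++ RS-tiles (tile b≤j done) , tile j<e rest-tiles , ≤-refl , j<e
  where j<e = ≤∧≢⇒< j≤e j≢e
step-progress (skip j≢e) (s , RS-tiles , L-tiles , b≤j , j≤e) =
  s , RS-tiles , L-tiles , m≤n⇒m≤1+n b≤j , ≤∧≢⇒< j≤e j≢e

progress-complete : ∀ {t L RS} → Progress t t (L , RS) → Tiles 1 RS t
progress-complete (_ , RS-tiles , done , _) = RS-tiles
progress-complete (_ , _ , tile _ rest-tiles , _ , t≤e) =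
  contradiction (tiles-≤ rest-tiles) (<⇒≱ (s≤s t≤e))

module Run (h m d : ℕ) (S : Haplotypes h m) where
  open Algo h m d S hiding (sym)

  -- Keeping only some of the boundaries f 0, …, f n (always including the last) merges
  -- adjacent unit intervals, so the result still tiles.
  intervalsFrom-filterᵇ-tiles : ∀ (p : ℕ → Bool) {f s} → Consecutive f → ∀ n → s ≤ f 0 →
    p (f n) ≡ true → Tiles s (intervalsFrom s (filterᵇ p (applyUpTo f (suc n)))) (suc (f n))
  intervalsFrom-filterᵇ-tiles p f-cons zero s≤f0 pfn rewrite pfn = tile s≤f0 done
  intervalsFrom-filterᵇ-tiles p {f} f-cons (suc n) s≤f0 pfn with p (f 0)
  ... | true  = tile s≤f0
    (intervalsFrom-filterᵇ-tiles p (f-cons ∘ suc) n (≤-reflexive (sym (f-cons 0))) pfn)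
  ... | false = intervalsFrom-filterᵇ-tiles p (f-cons ∘ suc) n
    (≤-trans (m≤n⇒m≤1+n s≤f0) (≤-reflexive (sym (f-cons 0)))) pfn

  PAcol-↭ : ∀ j → PAcol j ↭ allFin h
  PAcol-↭ j = sortBy-↭ (before j) (allFin h)

  ∈-PAcol : ∀ j c → c ∈ PAcol j
  ∈-PAcol j c = ∈-resp-↭ (↭-sym (PAcol-↭ j)) (∈-allFin c)

  PAcol-unique : ∀ j → Unique (PAcol j)
  PAcol-unique j =
    SetoidPermutation.Unique-resp-↭ (setoid (Fin h)) (↭⇒↭ₛ (↭-sym (PAcol-↭ j))) (allFin⁺ h)

hapIntervals-tiles : ∀ h m d S c → Tiles 1 (Algo.hapIntervals h m d S c) (suc m)
hapIntervals-tiles h zero    d S c = done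
hapIntervals-tiles h (suc n) d S c =
  subst (λ js → Tiles 1 (intervalsFrom 1 (filterᵇ isBoundary js)) (suc (suc n)))
    (sym (map-applyUpTo id suc (suc n)))
    (intervalsFrom-filterᵇ-tiles isBoundary {f = suc} (λ _ → refl) n (s≤s z≤n)
      (cong (_∨ any (finEq c) (runTopOwners (suc n))) (≡ᵇ-refl (suc n))))
  where
  open Run h (suc n) d S
  open Algo h (suc n) d S hiding (sym)
  isBoundary : ℕ → Bool
  isBoundary j = (j ≡ᵇ suc n) ∨ any (finEq c) (runTopOwners j)

module Haplotype (h m d : ℕ) (S : Haplotypes h m) (c : Fin h) where
  open Algo h m d S hiding (sym)
  open Run h m d S

  slot : State → List Interval × List Interval
  slot (L , RS) = L c , RS c

  activeStep-other : ∀ j prev x b e rest L RS → c ≢ x →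
    slot (activeStep j prev x b e rest (L , RS)) ≡ (L c , RS c)
  activeStep-other j nothing    x b e rest L RS c≢x = refl
  activeStep-other j (just c′) x b e rest L RS c≢x with numOverlap (b , j) (RS c′) ≡ᵇ d
  ... | true  = cong₂ _,_ (set-other L _ c≢x) (set-other RS _ c≢x)
  ... | false = refl

  stepCell-other : ∀ j prev x st → c ≢ x → slot (stepCell j prev x st) ≡ slot st
  stepCell-other j prev x (L , RS) c≢x with L x
  ... | []             = refl
  ... | (b , e) ∷ rest with j ≡ᵇ e
  ...   | true  = cong₂ _,_ (set-other L rest c≢x) (set-other RS _ c≢x)
  ...   | false = activeStep-other j prev x b e rest L RS c≢x

  activeStep-step : ∀ j prev b e rest L RS → L c ≡ (b , e) ∷ rest → j ≢ e →
    Step j ((b , e) ∷ rest , RS c) (slot (activeStep j prev c b e rest (L , RS)))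
  activeStep-step j nothing    b e rest L RS Lc≡ j≢e rewrite Lc≡ = skip j≢e
  activeStep-step j (just c′) b e rest L RS Lc≡ j≢e with numOverlap (b , j) (RS c′) ≡ᵇ d
  ... | true  rewrite set-same L c ((suc j , e) ∷ rest) | set-same RS c (RS c ++ [ (b , j) ]) =
    active j≢e
  ... | false rewrite Lc≡ = skip j≢e

  stepCell-step : ∀ j prev st → Step j (slot st) (slot (stepCell j prev c st))
  stepCell-step j prev (L , RS) with L c in Lc≡
  ... | []             rewrite Lc≡ = idle
  ... | (b , e) ∷ rest with j ≡ᵇ e | ≡ᵇ-reflects-≡ j e
  ...   | true  | ofʸ j≡e rewrite set-same L c rest | set-same RS c (RS c ++ [ (b , e) ]) =
    passive j≡e
  ...   | false | ofⁿ j≢e = activeStep-step j prev b e rest L RS Lc≡ j≢e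

  processCol-other : ∀ j prev cs st → All (c ≢_) cs → slot (processCol j prev cs st) ≡ slot st
  processCol-other j prev []       st []            = refl
  processCol-other j prev (x ∷ cs) st (c≢x ∷ c∉cs) =
    ≡-trans (processCol-other j (just x) cs _ c∉cs) (stepCell-other j prev x st c≢x)

  processCol-step : ∀ j prev cs st → c ∈ cs → Unique cs →
    Step j (slot st) (slot (processCol j prev cs st))
  processCol-step j prev (c ∷ cs) st (here refl) (c∉cs ∷ _) =
    subst (Step j (slot st)) (sym (processCol-other j (just c) cs _ c∉cs)) (stepCell-step j prev st)
  processCol-step j prev (x ∷ cs) st (there c∈cs) (x∉cs ∷ cs-unique) =
    subst (λ v → Step j v (slot (processCol j prev (x ∷ cs) st)))
      (stepCell-other j prev x st (≢-sym (All.lookup x∉cs c∈cs)))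
      (processCol-step j (just x) cs _ c∈cs cs-unique)

  column-step : ∀ j st → Step j (slot st) (slot (processCol j nothing (PAcol j) st))
  column-step j st = processCol-step j nothing (PAcol j) st (∈-PAcol j c) (PAcol-unique j)

  final-progress : Progress (suc m) (suc m) (slot final)
  final-progress =
    subst (λ js → Progress (suc m) (suc m) (slot (foldl processColumn initial js)))
      (sym (map-applyUpTo id suc m))
      (foldl-applyUpTo-preserves (λ j st → Progress (suc m) j (slot st)) processColumn
        (λ {j} {st} → step-progress (column-step j st)) (λ _ → refl) m
        (1 , done , hapIntervals-c-tiles , tiles-headContains hapIntervals-c-tiles))
    where
    processColumn : State → ℕ → State
    processColumn st j = processCol j nothing (PAcol j) st
    hapIntervals-c-tiles : Tiles 1 (hapIntervals c) (suc m)
    hapIntervals-c-tiles = hapIntervals-tiles h m d S c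

corollary6 : (h m d : ℕ) → 1 < d → (S : Haplotypes h m) → (c : Fin h) →
    PartitionsInterval m (refinedSegments h m d S c)
corollary6 h m d _ S c = tiles⇒partitions (progress-complete (Haplotype.final-progress h m d S c))
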